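{- Let $\mathbb{F}$ be a field of positive characteristic $p$ and $S$ an association scheme on a finite set $X$ with $O^\vartheta(S)\subseteq O_\vartheta(S)$. If $S$ is $p$-transitive, then $S=\langle S_{p'}\rangle$.
   Context: $S=\{R_0,\dots,R_d\}$ is an association scheme on $X$ with diagonal $R_0$, transposes $R_{i^*}$, intersection numbers $p_{ij}^k$, valencies $k_i=p_{ii^*}^0$. $S_{p'}=\{R_i\in S:p\nmid k_i\}$. For nonempty $U,V\subseteq S$, $UV=\{R_k:\exists R_u\in U,R_v\in V,\ p_{uv}^k>0\}$. A nonempty $T\subseteq S$ is closed if $T^*T\subseteq T$ ($T^*=\{R_{i^*}:R_i\in T\}$), strongly normal if also $R_{i^*}TR_i\subseteq T$ for all $i$. $\langle H\rangle$ is the intersection of all closed subsets containing $H$. $O_\vartheta(S)=\{R_i:k_i=1\}$; $O^\vartheta(S)$ is the intersection of all strongly normal closed subsets. $\overline{A_i}$ is the image in $M_X(\mathbb{F})$ of the adjacency matrix of $R_i$, $\mathbb{F}S=\mathrm{span}_{\mathbb{F}}\{\overline{A_i}\}$, $\overline{k_i}$ the image of $k_i$ in $\mathbb{F}$. A trivial submodule of the regular $\mathbb{F}S$-module is $\langle v\rangle_{\mathbb{F}}$ with $0\ne v\in\mathbb{F}S$ and $\overline{A_i}v=\overline{k_i}v$ for all $i$; $S$ is $p$-transitive if there is exactly one such submodule. -}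

module Defs where

open import Level using (Level)
open import Data.Nat using (ℕ; zero; suc; _<_)
open import Data.Nat.Divisibility using (_∣_)
open import Data.Fin using (Fin; _≟_) renaming (zero to fzero; suc to fsuc)
open import Data.Fin.Subset using (Subset; _∈_)
open import Data.Bool using (Bool; true; false; if_then_else_)
open import Data.Product using (Σ; ∃; _×_; _,_)
open import Relation.Nullary using (¬_; does)
open import Relation.Binary.PropositionalEquality using (_≡_)
open import Algebra.Bundles using (CommutativeRing)
import Algebra.Properties.Monoid.Sum as MonoidSum
import Algebra.Definitions.RawMonoid as RawMonoidDefs

count : ∀ {n} → (Fin n → Bool) → ℕ
count {zero}  f = 0
count {suc n} f = (if f fzero then 1 else 0) + count (λ i → f (fsuc i))
  where open Data.Nat using (_+_)

_==_ : ∀ {m} → Fin m → Fin m → Bool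
i == j = does (i ≟ j)

-- Association schemes on the finite set X = Fin n with relations
-- R_0 , … , R_d indexed by Fin (suc d).  rel x y = i  means (x,y) ∈ R_i,
-- so the R_i automatically partition X × X.

record AssocScheme (n d : ℕ) : Set where
  field
    rel       : Fin n → Fin n → Fin (suc d)
    nonempty  : ∀ i → ∃ λ x → ∃ λ y → rel x y ≡ i
    diag      : ∀ x y → rel x y ≡ fzero → x ≡ y
    diag-refl : ∀ x → rel x x ≡ fzero
    _*        : Fin (suc d) → Fin (suc d)
    transpose : ∀ x y → rel y x ≡ (rel x y) *
    p         : Fin (suc d) → Fin (suc d) → Fin (suc d) → ℕ
    p-spec    : ∀ i j k x y → rel x y ≡ k →
                count (λ z → (rel x z == i) Data.Bool.∧ (rel z y == j)) ≡ p i j k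

  val : Fin (suc d) → ℕ
  val i = p i (i *) fzero

module SchemeNotions {n d : ℕ} (S : AssocScheme n d) where
  open AssocScheme S

  Idx : Set
  Idx = Fin (suc d)

  SubS : Set₁
  SubS = Idx → Set

  _·_ : SubS → SubS → SubS
  (U · V) k = ∃ λ u → ∃ λ v → U u × V v × 0 < p u v k

  star : SubS → SubS
  star T k = ∃ λ t → T t × k ≡ t *

  single : Idx → SubS
  single i j = j ≡ i

  _⊆_ : SubS → SubS → Set
  U ⊆ V = ∀ k → U k → V k

  Closed : SubS → Set
  Closed T = (∃ λ t → T t) × ((star T · T) ⊆ T)

  StronglyNormalClosed : SubS → Set
  StronglyNormalClosed T = Closed T × (∀ i → ((single (i *) · T) · single i) ⊆ T)

  gen : SubS → SubS
  gen H k = ∀ (T : Subset (suc d)) → Closed (_∈ T) → H ⊆ (_∈ T) → k ∈ T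

  Oθ-lower : SubS
  Oθ-lower i = val i ≡ 1

  Oθ-upper : SubS
  Oθ-upper k = ∀ (T : Subset (suc d)) → StronglyNormalClosed (_∈ T) → k ∈ T

  S-p' : ℕ → SubS
  S-p' q i = ¬ (q ∣ val i)

module _ {c ℓ : Level} (F : CommutativeRing c ℓ) where
  open CommutativeRing F
  open RawMonoidDefs +-rawMonoid using () renaming (_×_ to _·ℕ_)

  IsField : Set (c Level.⊔ ℓ)
  IsField = (¬ (1# ≈ 0#)) × (∀ x → ¬ (x ≈ 0#) → ∃ λ y → (x * y) ≈ 1#)

  HasCharacteristic : ℕ → Set ℓ
  HasCharacteristic q = (0 < q) × ((q ·ℕ 1#) ≈ 0#) ×
                        (∀ m → 0 < m → m < q → ¬ ((m ·ℕ 1#) ≈ 0#))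

module SchemeAlgebra {c ℓ : Level} (F : CommutativeRing c ℓ)
                     {n d : ℕ} (S : AssocScheme n d) where
  open CommutativeRing F
  open RawMonoidDefs +-rawMonoid using () renaming (_×_ to _·ℕ_)
  open MonoidSum +-monoid using (sum)
  open AssocScheme S

  Mat : Set c
  Mat = Fin n → Fin n → Carrier

  _≈M_ : Mat → Mat → Set ℓ
  A ≈M B = ∀ x y → A x y ≈ B x y

  0M : Mat
  0M x y = 0#

  _·M_ : Mat → Mat → Mat
  (A ·M B) x y = sum (λ z → A x z * B z y)

  _⊙_ : Carrier → Mat → Mat
  (a ⊙ A) x y = a * A x y

  _+M_ : Mat → Mat → Mat
  (A +M B) x y = A x y + B x y

  Adj : Fin (suc d) → Mat
  Adj i x y = if rel x y == i then 1# else 0#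

  combo : (Fin (suc d) → Carrier) → Mat
  combo cs x y = sum (λ j → (cs j ⊙ Adj j) x y)

  InFS : Mat → Set (c Level.⊔ ℓ)
  InFS v = ∃ λ (cs : Fin (suc d) → Carrier) → v ≈M combo cs

  kbar : Fin (suc d) → Carrier
  kbar i = val i ·ℕ 1#

  -- v spans a trivial submodule of the regular FS-module
  TrivialGen : Mat → Set (c Level.⊔ ℓ)
  TrivialGen v = InFS v × (¬ (v ≈M 0M)) × (∀ i → (Adj i ·M v) ≈M (kbar i ⊙ v))

  -- S is p-transitive: exactly one trivial submodule, i.e. some trivial
  -- generator exists and any two trivial generators span the same
  -- F-subspace ⟨v⟩_F = ⟨w⟩_F.
  SameSpan : Mat → Mat → Set (c Level.⊔ ℓ)
  SameSpan v w = (∃ λ a → w ≈M (a ⊙ v)) × (∃ λ b → v ≈M (b ⊙ w))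

  PTransitive : Set (c Level.⊔ ℓ)
  PTransitive = (∃ λ v → TrivialGen v) × (∀ v w → TrivialGen v → TrivialGen w → SameSpan v w)

{-# OPTIONS --safe #-}
module Submission where

-- The indicator matrix σ_T of a closed subset T ⊇ S_{p'} spans a trivial
-- submodule. For R_i ∈ T this is closedness of T. For R_i ∉ T the points z
-- with (x,z) ∈ R_i are pairwise related by relations of O^θ(S) ⊆ O_θ(S) ⊆ S_{p'} ⊆ T,
-- so the (x,y)-entry of Ā_i σ_T counts either none or all k_i of them, and
-- p ∣ k_i because R_i ∉ S_{p'}. The all-ones matrix σ_S spans a trivial
-- submodule as well, so p-transitivity makes σ_S a multiple of σ_T, i.e. T = S.

open import Defs
open import Level using (Level)
open import Data.Nat as ℕ using (ℕ; zero; suc; _<_; z≤n; s≤s)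
open import Data.Nat.Properties using (<-≤-trans; m≤n+m)
open import Data.Nat.Divisibility using (_∣_; _∣?_; divides; _∣0; ∣1⇒≡1)
open import Data.Fin using (Fin; _≟_) renaming (zero to fzero; suc to fsuc)
open import Data.Fin.Subset using (Subset; _∈_; ⊤)
open import Data.Fin.Subset.Properties using (_∈?_; ∈⊤)
open import Data.Bool using (Bool; true; false; if_then_else_; _∧_)
open import Data.Bool.Properties using (∧-identityʳ; ∧-zeroʳ)
open import Data.Product using (∃; _,_; proj₁; proj₂)
open import Data.Sum using (_⊎_; inj₁; inj₂)
open import Data.Empty using (⊥-elim)
open import Function using (_∘_; mk⇔)
open import Relation.Nullary using (¬_; does; yes; no; Dec)
open import Relation.Nullary.Decidable using (dec-true; dec-false; does-⇔)
open import Relation.Binary.PropositionalEquality as ≡ using (_≡_; _≢_)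
open import Algebra.Bundles using (CommutativeRing)
import Algebra.Definitions.RawMonoid as RawMonoidDefs
import Algebra.Properties.Monoid.Mult as MonoidMult
import Algebra.Properties.Monoid.Sum as MonoidSum
import Relation.Binary.Reasoning.Setoid as SetoidReasoning

==⇒≡ : ∀ {m} {i j : Fin m} → (i == j) ≡ true → i ≡ j
==⇒≡ {i = i} {j} eq with i ≟ j
... | yes i≡j = i≡j

==-refl : ∀ {m} (i : Fin m) → (i == i) ≡ true
==-refl i = dec-true (i ≟ i) ≡.refl

count-cong : ∀ {m} {f g : Fin m → Bool} → (∀ z → f z ≡ g z) → count f ≡ count g
count-cong {zero}  f≗g = ≡.refl
count-cong {suc m} f≗g =
  ≡.cong₂ ℕ._+_ (≡.cong (λ b → if b then 1 else 0) (f≗g fzero)) (count-cong (λ z → f≗g (fsuc z)))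

count-false : ∀ m → count {m} (λ _ → false) ≡ 0
count-false zero    = ≡.refl
count-false (suc m) = count-false m

count≡0⊎witness : ∀ {m} (f : Fin m → Bool) → count f ≡ 0 ⊎ ∃ λ z → f z ≡ true
count≡0⊎witness {zero}  f = inj₁ ≡.refl
count≡0⊎witness {suc m} f with f fzero in eq
... | true  = inj₂ (fzero , eq)
... | false with count≡0⊎witness (λ z → f (fsuc z))
...   | inj₁ c≡0       = inj₁ c≡0
...   | inj₂ (z , fz) = inj₂ (fsuc z , fz)

witness⇒count>0 : ∀ {m} (f : Fin m → Bool) z → f z ≡ true → 0 < count f
witness⇒count>0 f fzero    fz rewrite fz = s≤s z≤n
witness⇒count>0 f (fsuc z) fz =
  <-≤-trans (witness⇒count>0 (λ z → f (fsuc z)) z fz)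
            (m≤n+m (count (λ z → f (fsuc z))) (if f fzero then 1 else 0))

count-∧-const : ∀ {m} (f g : Fin m → Bool) b → (∀ z → f z ≡ true → g z ≡ b) →
                count (λ z → f z ∧ g z) ≡ (if b then count f else 0)
count-∧-const {m} f g b g≡b = ≡.trans (count-cong f∧g≗f∧b) (count-∧ b)
  where
    f∧g≗f∧b : ∀ z → (f z ∧ g z) ≡ (f z ∧ b)
    f∧g≗f∧b z with f z in fz
    ... | true  = g≡b z fz
    ... | false = ≡.refl

    count-∧ : ∀ b → count (λ z → f z ∧ b) ≡ (if b then count f else 0)
    count-∧ true  = count-cong (λ z → ∧-identityʳ (f z))
    count-∧ false = ≡.trans (count-cong (λ z → ∧-zeroʳ (f z))) (count-false m)

count-∧-fiberConst : ∀ {m} (f g : Fin m → Bool) →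
                     (∀ z z′ → f z ≡ true → f z′ ≡ true → g z ≡ g z′) →
                     count (λ z → f z ∧ g z) ≡ 0 ⊎ count (λ z → f z ∧ g z) ≡ count f
count-∧-fiberConst f g g-const with count≡0⊎witness (λ z → f z ∧ g z)
... | inj₁ c≡0 = inj₁ c≡0
... | inj₂ (z₀ , fz₀∧gz₀) with f z₀ in fz₀ | g z₀ in gz₀
...   | true | true = inj₂ (count-∧-const f g true (λ z fz → ≡.trans (g-const z z₀ fz fz₀) gz₀))

module RingSums {c ℓ : Level} (F : CommutativeRing c ℓ) where
  open CommutativeRing F
  open RawMonoidDefs +-rawMonoid using () renaming (_×_ to _·ℕ_)
  open MonoidSum +-monoid using (sum; sum-cong-≋; sum-replicate-zero)
  open MonoidMult +-monoid using (×-homo-+; ×-assocˡ; ×-congʳ)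
  open SetoidReasoning setoid

  ind : Bool → Carrier
  ind b = if b then 1# else 0#

  ind-∧ : ∀ a b → ind a * ind b ≈ ind (a ∧ b)
  ind-∧ true  true  = *-identityʳ 1#
  ind-∧ true  false = zeroʳ 1#
  ind-∧ false b     = zeroˡ (ind b)

  sum-ind≈count : ∀ {m} (f : Fin m → Bool) → sum (λ z → ind (f z)) ≈ count f ·ℕ 1#
  sum-ind≈count {zero}  f = refl
  sum-ind≈count {suc m} f = begin
    ind (f fzero) + sum (λ z → ind (f (fsuc z)))
      ≈⟨ +-cong (ind≈ (f fzero)) (sum-ind≈count (λ z → f (fsuc z))) ⟩
    (if f fzero then 1 else 0) ·ℕ 1# + count (λ z → f (fsuc z)) ·ℕ 1#
      ≈⟨ ×-homo-+ 1# (if f fzero then 1 else 0) (count (λ z → f (fsuc z))) ⟨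
    count f ·ℕ 1# ∎
    where
      ind≈ : ∀ b → ind b ≈ (if b then 1 else 0) ·ℕ 1#
      ind≈ true  = sym (+-identityʳ 1#)
      ind≈ false = refl

  sum-*ind-== : ∀ {m} (cs : Fin m → Carrier) a → sum (λ j → cs j * ind (a == j)) ≈ cs a
  sum-*ind-== {suc m} cs fzero = begin
    cs fzero * 1# + sum (λ j → cs (fsuc j) * 0#)
      ≈⟨ +-cong (*-identityʳ (cs fzero)) (sum-cong-≋ (λ j → zeroʳ (cs (fsuc j)))) ⟩
    cs fzero + sum {m} (λ _ → 0#)
      ≈⟨ +-congˡ (sum-replicate-zero m) ⟩
    cs fzero + 0#
      ≈⟨ +-identityʳ (cs fzero) ⟩
    cs fzero ∎
  sum-*ind-== cs (fsuc a) = begin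
    cs fzero * 0# + sum (λ j → cs (fsuc j) * ind (a == j))
      ≈⟨ +-cong (zeroʳ (cs fzero)) (sum-*ind-== (λ j → cs (fsuc j)) a) ⟩
    0# + cs (fsuc a)
      ≈⟨ +-identityˡ (cs (fsuc a)) ⟩
    cs (fsuc a) ∎

  if·ℕ1# : ∀ m b → (if b then m else 0) ·ℕ 1# ≈ (m ·ℕ 1#) * ind b
  if·ℕ1# m true  = sym (*-identityʳ (m ·ℕ 1#))
  if·ℕ1# m false = sym (zeroʳ (m ·ℕ 1#))

  ∣⇒·ℕ1#≈0 : ∀ {q m} → q ·ℕ 1# ≈ 0# → q ∣ m → m ·ℕ 1# ≈ 0#
  ∣⇒·ℕ1#≈0 {q} q1≈0 (divides k ≡.refl) = begin
    (k ℕ.* q) ·ℕ 1#       ≈⟨ ×-assocˡ 1# k q ⟨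
    k ·ℕ (q ·ℕ 1#)        ≈⟨ ×-congʳ k q1≈0 ⟩
    k ·ℕ 0#               ≈⟨ ·ℕ0≈0 k ⟩
    0#                    ∎
    where
      ·ℕ0≈0 : ∀ k → k ·ℕ 0# ≈ 0#
      ·ℕ0≈0 zero    = refl
      ·ℕ0≈0 (suc k) = trans (+-identityˡ (k ·ℕ 0#)) (·ℕ0≈0 k)

  ·ℕ1#≈0⇒≢1 : ¬ (1# ≈ 0#) → ∀ {q} → q ·ℕ 1# ≈ 0# → q ≢ 1
  ·ℕ1#≈0⇒≢1 1≉0 q1≈0 ≡.refl = 1≉0 (trans (sym (+-identityʳ 1#)) q1≈0)

module SchemeProperties {n d : ℕ} (S : AssocScheme n d) where
  open AssocScheme S
  open SchemeNotions S

  path⇒p>0 : ∀ {x z y u v} → rel x z ≡ u → rel z y ≡ v → 0 < p u v (rel x y)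
  path⇒p>0 {x} {z} {y} ≡.refl ≡.refl =
    ≡.subst (0 <_) (p-spec (rel x z) (rel z y) (rel x y) x y ≡.refl)
      (witness⇒count>0 _ z (≡.cong₂ _∧_ (==-refl (rel x z)) (==-refl (rel z y))))

  row-count≡val : ∀ x i → count (λ z → rel x z == i) ≡ val i
  row-count≡val x i = ≡.trans (count-cong row≗pair) (p-spec i (i *) fzero x x (diag-refl x))
    where
      row≗pair : ∀ z → (rel x z == i) ≡ ((rel x z == i) ∧ (rel z x == (i *)))
      row≗pair z with rel x z == i in xz
      ... | false = ≡.refl
      ... | true  = ≡.sym (≡.subst (λ w → (w == (i *)) ≡ true)
                      (≡.sym (≡.trans (transpose x z) (≡.cong _* (==⇒≡ xz)))) (==-refl (i *)))

  module ClosedSubset (U : Subset (suc d)) (U-closed : Closed (_∈ U)) where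

    ∈-compose : ∀ {x z y} → rel z x ∈ U → rel z y ∈ U → rel x y ∈ U
    ∈-compose {x} {z} {y} zx∈U zy∈U = proj₂ U-closed (rel x y)
      (rel x z , rel z y , (rel z x , zx∈U , transpose z x) , zy∈U , path⇒p>0 ≡.refl ≡.refl)

    0∈ : fzero ∈ U
    0∈ with proj₁ U-closed
    ... | (t , t∈U) with nonempty t
    ...   | (a , b , ab≡t) = ≡.subst (_∈ U) (diag-refl b) (∈-compose {b} {a} {b} ab∈U ab∈U)
      where ab∈U = ≡.subst (_∈ U) (≡.sym ab≡t) t∈U

    rel-refl∈ : ∀ x → rel x x ∈ U
    rel-refl∈ x = ≡.subst (_∈ U) (≡.sym (diag-refl x)) 0∈

    rel-sym∈ : ∀ {x y} → rel x y ∈ U → rel y x ∈ U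
    rel-sym∈ {x} {y} xy∈U = ∈-compose {y} {x} {x} xy∈U (rel-refl∈ x)

    rel-trans∈ : ∀ {x y z} → rel x y ∈ U → rel y z ∈ U → rel x z ∈ U
    rel-trans∈ {x} {y} {z} xy∈U yz∈U = ∈-compose {x} {y} {z} (rel-sym∈ xy∈U) yz∈U

  -- (z′, z) ∈ R_{i*} R_0 R_i for i = rel x z, and R_0 lies in every closed subset.
  row-fiber⇒Oθ-upper : ∀ {x z z′} → rel x z ≡ rel x z′ → Oθ-upper (rel z′ z)
  row-fiber⇒Oθ-upper {x} {z} {z′} xz≡xz′ U (U-closed , U-normal) =
    U-normal (rel x z) (rel z′ z)
      (rel z′ x , rel x z ,
       (rel x z * , fzero , ≡.refl , 0∈ , path⇒p>0 {z′} {x} {x} z′x≡xz* (diag-refl x)) ,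
       ≡.refl , path⇒p>0 ≡.refl ≡.refl)
    where
      open ClosedSubset U U-closed
      z′x≡xz* : rel z′ x ≡ rel x z *
      z′x≡xz* = ≡.trans (transpose x z′) (≡.cong _* (≡.sym xz≡xz′))

  Oθ-lower⊆S-p' : ∀ {q} → q ≢ 1 → Oθ-lower ⊆ S-p' q
  Oθ-lower⊆S-p' q≢1 i val≡1 q∣val = q≢1 (∣1⇒≡1 (≡.subst (_ ∣_) val≡1 q∣val))

module IndicatorMatrix {c ℓ : Level} (F : CommutativeRing c ℓ)
                       {n d : ℕ} (S : AssocScheme n d) where
  open AssocScheme S
  open SchemeNotions S
  open SchemeAlgebra F S
  open SchemeProperties S
  open CommutativeRing F
  open RingSums F
  open RawMonoidDefs +-rawMonoid using () renaming (_×_ to _·ℕ_)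
  open MonoidSum +-monoid using (sum; sum-cong-≋)
  open SetoidReasoning setoid

  _∈ᵇ_ : Fin (suc d) → Subset (suc d) → Bool
  j ∈ᵇ U = does (j ∈? U)

  σ : Subset (suc d) → Mat
  σ U x y = ind (rel x y ∈ᵇ U)

  σ-∈ : ∀ U {x y} → rel x y ∈ U → σ U x y ≈ 1#
  σ-∈ U {x} {y} xy∈U rewrite dec-true (rel x y ∈? U) xy∈U = refl

  σ-∉ : ∀ U {x y} → ¬ (rel x y ∈ U) → σ U x y ≈ 0#
  σ-∉ U {x} {y} xy∉U rewrite dec-false (rel x y ∈? U) xy∉U = refl

  σ-InFS : ∀ U → InFS (σ U)
  σ-InFS U = (λ j → ind (j ∈ᵇ U)) , λ x y → sym (sum-*ind-== (λ j → ind (j ∈ᵇ U)) (rel x y))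

  σ-≉0M : ¬ (1# ≈ 0#) → ∀ U → Closed (_∈ U) → ¬ (σ U ≈M 0M)
  σ-≉0M 1≉0 U U-closed σ≈0 with nonempty fzero
  ... | (x , _ , _) = 1≉0 (trans (sym (σ-∈ U (rel-refl∈ x))) (σ≈0 x x))
    where open ClosedSubset U U-closed

  module _ (q : ℕ) (q1≈0 : q ·ℕ 1# ≈ 0#) (U : Subset (suc d)) (U-closed : Closed (_∈ U))
           (Oθ-upper⊆U : Oθ-upper ⊆ (_∈ U)) (S-p'⊆U : S-p' q ⊆ (_∈ U)) where
    open ClosedSubset U U-closed

    q∣val-outside : ∀ i → ¬ (i ∈ U) → q ∣ val i
    q∣val-outside i i∉U with q ∣? val i
    ... | yes q∣val = q∣val
    ... | no  q∤val = ⊥-elim (i∉U (S-p'⊆U i q∤val))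

    σ-eigen : ∀ i → (Adj i ·M σ U) ≈M (kbar i ⊙ σ U)
    σ-eigen i x y = begin
      sum (λ z → ind (f z) * ind (g z)) ≈⟨ sum-cong-≋ (λ z → ind-∧ (f z) (g z)) ⟩
      sum (λ z → ind (f z ∧ g z))       ≈⟨ sum-ind≈count (λ z → f z ∧ g z) ⟩
      count (λ z → f z ∧ g z) ·ℕ 1#     ≈⟨ count≈ (i ∈? U) ⟩
      kbar i * σ U x y                  ∎
      where
        f g : Fin n → Bool
        f z = rel x z == i
        g z = rel z y ∈ᵇ U

        g≡xy : i ∈ U → ∀ z → f z ≡ true → g z ≡ (rel x y ∈ᵇ U)
        g≡xy i∈U z fz =
          does-⇔ (mk⇔ (rel-trans∈ xz∈U) (rel-trans∈ (rel-sym∈ xz∈U))) (rel z y ∈? U) (rel x y ∈? U)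
          where xz∈U = ≡.subst (_∈ U) (≡.sym (==⇒≡ fz)) i∈U

        g-fiberConst : ∀ z z′ → f z ≡ true → f z′ ≡ true → g z ≡ g z′
        g-fiberConst z z′ fz fz′ =
          does-⇔ (mk⇔ (rel-trans∈ z′z∈U) (rel-trans∈ (rel-sym∈ z′z∈U))) (rel z y ∈? U) (rel z′ y ∈? U)
          where z′z∈U = Oθ-upper⊆U _ (row-fiber⇒Oθ-upper (≡.trans (==⇒≡ fz) (≡.sym (==⇒≡ fz′))))

        count≈ : Dec (i ∈ U) → count (λ z → f z ∧ g z) ·ℕ 1# ≈ kbar i * σ U x y
        count≈ (yes i∈U) = begin
          count (λ z → f z ∧ g z) ·ℕ 1#
            ≡⟨ ≡.cong (_·ℕ 1#) (count-∧-const f g _ (g≡xy i∈U)) ⟩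
          (if rel x y ∈ᵇ U then count f else 0) ·ℕ 1#
            ≈⟨ if·ℕ1# (count f) (rel x y ∈ᵇ U) ⟩
          (count f ·ℕ 1#) * σ U x y
            ≡⟨ ≡.cong (λ k → (k ·ℕ 1#) * σ U x y) (row-count≡val x i) ⟩
          kbar i * σ U x y ∎
        count≈ (no i∉U) = begin
          count (λ z → f z ∧ g z) ·ℕ 1# ≈⟨ ∣⇒·ℕ1#≈0 q1≈0 q∣count ⟩
          0#                            ≈⟨ zeroˡ (σ U x y) ⟨
          0# * σ U x y                  ≈⟨ *-congʳ (∣⇒·ℕ1#≈0 q1≈0 q∣val) ⟨
          kbar i * σ U x y              ∎
          where
            q∣val = q∣val-outside i i∉U
            q∣count : q ∣ count (λ z → f z ∧ g z)
            q∣count with count-∧-fiberConst f g g-fiberConst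
            ... | inj₁ c≡0 = ≡.subst (q ∣_) (≡.sym c≡0) (q ∣0)
            ... | inj₂ c≡f = ≡.subst (q ∣_) (≡.sym (≡.trans c≡f (row-count≡val x i))) q∣val

    σ-trivialGen : ¬ (1# ≈ 0#) → TrivialGen (σ U)
    σ-trivialGen 1≉0 = σ-InFS U , σ-≉0M 1≉0 U U-closed , σ-eigen

  proportional-σ⇒⊆ : ¬ (1# ≈ 0#) → ∀ U V {a} → σ U ≈M (a ⊙ σ V) → (_∈ U) ⊆ (_∈ V)
  proportional-σ⇒⊆ 1≉0 U V {a} σU≈aσV i i∈U with i ∈? V
  ... | yes i∈V = i∈V
  ... | no  i∉V with nonempty i
  ...   | (x , y , xy≡i) = ⊥-elim (1≉0 (begin
    1#          ≈⟨ σ-∈ U (≡.subst (_∈ U) (≡.sym xy≡i) i∈U) ⟨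
    σ U x y     ≈⟨ σU≈aσV x y ⟩
    a * σ V x y ≈⟨ *-congˡ (σ-∉ V (λ xy∈V → i∉V (≡.subst (_∈ V) xy≡i xy∈V))) ⟩
    a * 0#      ≈⟨ zeroʳ a ⟩
    0#          ∎))

corollary4p3 : ∀ {c ℓ : Level} (F : CommutativeRing c ℓ) → IsField F →
    (q : ℕ) → HasCharacteristic F q →
    (n d : ℕ) (S : AssocScheme n d) →
    SchemeNotions._⊆_ S (SchemeNotions.Oθ-upper S) (SchemeNotions.Oθ-lower S) →
    SchemeAlgebra.PTransitive F S →
    ∀ i → SchemeNotions.gen S (SchemeNotions.S-p' S q) i
corollary4p3 F (1≉0 , _) q (_ , q1≈0 , _) n d S Oθ-upper⊆Oθ-lower (_ , unique) i T T-closed S-p'⊆T =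
  proportional-σ⇒⊆ 1≉0 ⊤ T (proj₂ J∝σT) i ∈⊤
  where
    open SchemeNotions S
    open SchemeAlgebra F S using (TrivialGen; _≈M_; _⊙_)
    open SchemeProperties S
    open IndicatorMatrix F S
    open RingSums F using (·ℕ1#≈0⇒≢1)

    Oθ-upper⊆T : Oθ-upper ⊆ (_∈ T)
    Oθ-upper⊆T j = S-p'⊆T j ∘ Oθ-lower⊆S-p' (·ℕ1#≈0⇒≢1 1≉0 q1≈0) j ∘ Oθ-upper⊆Oθ-lower j

    ⊤-closed : Closed (_∈ ⊤)
    ⊤-closed = (fzero , ∈⊤) , λ _ _ → ∈⊤

    σT-trivial : TrivialGen (σ T)
    σT-trivial = σ-trivialGen q q1≈0 T T-closed Oθ-upper⊆T S-p'⊆T 1≉0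

    J-trivial : TrivialGen (σ ⊤)
    J-trivial = σ-trivialGen q q1≈0 ⊤ ⊤-closed (λ _ _ → ∈⊤) (λ _ _ → ∈⊤) 1≉0

    J∝σT : ∃ λ a → σ ⊤ ≈M (a ⊙ σ T)
    J∝σT = proj₁ (unique (σ T) (σ ⊤) σT-trivial J-trivial)
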